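{- Let $p>3$ be a prime, $\kappa\in\mathbb{Z}$, $n\in\mathbb{Z}_{>0}$, and let $K=(X_1,X_2,X_3;Y_1,Y_2,Y_3)\in\mathcal{K}^{\mathrm{prop}}_{n,\kappa}(p)$. Then: (1) for all $1\le i\ne j\le 3$, every internal vertex $W$ of the $X_i$-$Y_j$-path satisfies $R_i(W)\ne W$ and $R_j(W)\ne W$; (2) any two distinct paths among the nine paths of $K$ (the $X_i$-$Y_i$-paths for $1\le i\le 3$ and the $X_i$-$Y_j$-paths for $1\le i\ne j\le 3$) share no edges. In particular, $K$ (viewed as a subgraph) is a subdivision of $K_{3,3}$ in $\mathcal{G}_\kappa(p)$, with parts $\{X_1,X_2,X_3\}$ and $\{Y_1,Y_2,Y_3\}$.
   Context: Let $p>3$ be a prime and $\kappa\in\mathbb{Z}$, regarded as an element of $\mathbb{F}_p$. Let $\mathcal{M}_\kappa(p)=\{(x,y,z)\in\mathbb{F}_p^3 : x^2+y^2+z^2=xyz+\kappa\}$, with Vieta involutions $R_1(x,y,z)=(yz-x,y,z)$, $R_2(x,y,z)=(x,zx-y,z)$, $R_3(x,y,z)=(x,y,xy-z)$. $\mathcal{G}_\kappa(p)$ is the $3$-regular graph (possibly with loops) on $\mathcal{M}_\kappa(p)$ with an edge joining $X$ and $R_i(X)$ for each $X$ and $i$. Compositions $R_iR_j$ mean apply $R_j$ first, then $R_i$. For $n\in\mathbb{Z}_{>0}$, $\mathcal{K}^{\mathrm{all}}_{n,\kappa}(p)$ is the set of sextuples $(X_1,X_2,X_3;Y_1,Y_2,Y_3)$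 of elements of $\mathcal{M}_\kappa(p)$ with $Y_1=R_1(X_1)=(R_2R_1)^n(X_2)=(R_3R_1)^n(X_3)$, $Y_2=R_2(X_2)=(R_3R_2)^n(X_3)=(R_1R_2)^n(X_1)$, $Y_3=R_3(X_3)=(R_1R_3)^n(X_1)=(R_2R_3)^n(X_2)$. Such a sextuple is identified with the subgraph consisting of the six vertices, the three $X_i$-$Y_i$-paths $(X_i,R_i(X_i)=Y_i)$ of length $1$, and for $1\le i\ne j\le3$ the $X_i$-$Y_j$-path $(X_i,R_j(X_i),(R_iR_j)(X_i),R_j(R_iR_j)(X_i),\dots,R_j(R_iR_j)^{n-1}(X_i),(R_iR_j)^n(X_i)=Y_j)$ of length $2n$. $K$ is distinct if the six triples are pairwise distinct; $\mathcal{K}^{\mathrm{dist}}_{n,\kappa}(p)$ is the set of distinct elements of $\mathcal{K}^{\mathrm{all}}_{n,\kappa}(p)$. $K$ is proper if it is distinct and none of $X_1,X_2,X_3,Y_1,Y_2,Y_3$ is an internal vertex of any $X_i$-$Y_j$-path with $i\ne j$; $\mathcal{K}^{\mathrm{prop}}_{n,\kappa}(p)$ is the set of proper elements. -}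

module Defs where

open import Data.Nat using (ℕ; zero; suc; _+_; _*_; _∸_; _<_; _≤_; NonZero; _%_)
open import Data.Nat.DivMod using (m%n<n)
open import Data.Integer using (ℤ; _%ℕ_)
open import Data.Integer.DivMod using (n%ℕd<d)
open import Data.Fin using (Fin; toℕ; fromℕ<)
open import Data.Product using (_×_; _,_; Σ)
open import Data.Sum using (_⊎_)
open import Relation.Binary.PropositionalEquality using (_≡_; _≢_)
open import Relation.Nullary using (¬_; Dec; yes; no)
open import Relation.Nullary.Decidable using (does)
open import Data.Bool using (Bool; true; false; not; if_then_else_)
import Data.Fin as F

module _ (p : ℕ) .{{_ : NonZero p}} where

  Fp : Set
  Fp = Fin p

  red : ℕ → Fp
  red m = fromℕ< (m%n<n m p)

  _⊕_ : Fp → Fp → Fp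
  a ⊕ b = red (toℕ a + toℕ b)

  _⊗_ : Fp → Fp → Fp
  a ⊗ b = red (toℕ a * toℕ b)

  ⊖_ : Fp → Fp
  ⊖ a = red (p ∸ toℕ a)

  _⊝_ : Fp → Fp → Fp
  a ⊝ b = a ⊕ (⊖ b)

  ιℤ : ℤ → Fp
  ιℤ κ = fromℕ< (n%ℕd<d κ p)

  Tri : Set
  Tri = Fp × Fp × Fp

  InM : ℤ → Tri → Set
  InM κ (x , y , z) =
    ((x ⊗ x) ⊕ (y ⊗ y)) ⊕ (z ⊗ z) ≡ ((x ⊗ y) ⊗ z) ⊕ ιℤ κ

  R₁ R₂ R₃ : Tri → Tri
  R₁ (x , y , z) = ((y ⊗ z) ⊝ x , y , z)
  R₂ (x , y , z) = (x , (z ⊗ x) ⊝ y , z)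
  R₃ (x , y , z) = (x , y , (x ⊗ y) ⊝ z)

  R : Fin 3 → Tri → Tri
  R F.zero = R₁
  R (F.suc F.zero) = R₂
  R (F.suc (F.suc F.zero)) = R₃

iter : {A : Set} → ℕ → (A → A) → A → A
iter zero    f a = a
iter (suc m) f a = f (iter m f a)

-- Path (i , j) starts at X i; its k-th step uses the edge of label
-- lab i j k = j for k even, i for k odd.  For i ≡ j it has length 1
-- (the X_i–Y_i path), for i ≢ j it has length 2n (the X_i–Y_j path).

isEven : ℕ → Bool
isEven zero    = true
isEven (suc k) = not (isEven k)

lab : Fin 3 → Fin 3 → ℕ → Fin 3
lab i j k = if isEven k then j else i

len : ℕ → Fin 3 → Fin 3 → ℕ
len n i j = if does (i F.≟ j) then 1 else 2 * n

module _ (p : ℕ) .{{_ : NonZero p}} where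

  pv : (Fin 3 → Tri p) → Fin 3 → Fin 3 → ℕ → Tri p
  pv X i j zero    = X i
  pv X i j (suc k) = R p (lab i j k) (pv X i j k)

  -- An edge of G_κ(p): a label together with its two endpoints
  -- (the second endpoint being R_label of the first).
  Edge : Set
  Edge = Fin 3 × Tri p × Tri p

  pe : (Fin 3 → Tri p) → Fin 3 → Fin 3 → ℕ → Edge
  pe X i j k = (lab i j k , pv X i j k , pv X i j (suc k))

  SameEdge : Edge → Edge → Set
  SameEdge (l , a , b) (l' , a' , b') =
    l ≡ l' × ((a ≡ a' × b ≡ b') ⊎ (a ≡ b' × b ≡ a'))

  IsKall : ℤ → ℕ → (X Y : Fin 3 → Tri p) → Set
  IsKall κ n X Y =
    (∀ i → InM p κ (X i)) × (∀ i → InM p κ (Y i)) ×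
    (∀ i → Y i ≡ R p i (X i)) ×
    (∀ i j → i ≢ j → iter n (λ W → R p i (R p j W)) (X i) ≡ Y j)

  IsDistinct : ℤ → ℕ → (X Y : Fin 3 → Tri p) → Set
  IsDistinct κ n X Y =
    IsKall κ n X Y ×
    (∀ i j → i ≢ j → X i ≢ X j) ×
    (∀ i j → i ≢ j → Y i ≢ Y j) ×
    (∀ i j → X i ≢ Y j)

  IsProper : ℤ → ℕ → (X Y : Fin 3 → Tri p) → Set
  IsProper κ n X Y =
    IsDistinct κ n X Y ×
    (∀ i j → i ≢ j → ∀ k → 0 < k → k < 2 * n → ∀ l →
       pv X i j k ≢ X l × pv X i j k ≢ Y l)

  IsK33Subdivision : ℕ → (X Y : Fin 3 → Tri p) → Set
  IsK33Subdivision n X Y =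
    (∀ i j → i ≢ j → X i ≢ X j) ×
    (∀ i j → i ≢ j → Y i ≢ Y j) ×
    (∀ i j → X i ≢ Y j) ×
    (∀ i j → pv X i j (len n i j) ≡ Y j) ×
    (∀ i j k k' → k ≤ len n i j → k' ≤ len n i j → k ≢ k' →
       pv X i j k ≢ pv X i j k') ×
    (∀ i j i' j' → (i , j) ≢ (i' , j') → ∀ k k' →
       0 < k → k < len n i j → k' ≤ len n i' j' →
       pv X i j k ≢ pv X i' j' k') ×
    (∀ i j i' j' → (i , j) ≢ (i' , j') → ∀ k k' →
       k < len n i j → k' < len n i' j' →
       ¬ SameEdge (pe X i j k) (pe X i' j' k'))

module Submission where

-- Every vertex reached from the X_i lies on M_κ(p), and a line parallel to a coordinate axis
-- meets M_κ(p) in the two roots of a monic quadratic, which the Vieta involution R_m swaps.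
-- Continued with the same alternating labels, the X_i–Y_j path runs on through X_j, the
-- X_j–Y_i path and Y_i back to X_i: a closed walk of length 4n + 2 on which X_i occurs once.
-- In a walk alternating two involutions a repeated vertex forces a translation (even gap)
-- or a reflection about a fixed edge (odd gap), and either would make X_i reappear; this
-- gives (1) and the disjointness of the X_i–Y_j and X_j–Y_i paths. Two paths with exactly
-- one common index m each keep one of the two coordinates other than m at its value at X_m,
-- so a common vertex lies on the axis-parallel line through X_m and equals X_m or
-- R_m(X_m) = Y_m, which properness forbids. Every edge of a path of length 2n has an
-- internal endpoint, so no edge is shared either.

open import Algebra.Bundles using (CommutativeRing)
open import Data.Sum using (_⊎_; inj₁; inj₂)
import Data.Sum as Sum
open import Level using (Level)

-- Roots of a quadratic over a commutative ring

module QuadraticRoots {a ℓ : Level} (R : CommutativeRing a ℓ) where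

  open CommutativeRing R
  open import Algebra.Properties.Group +-group
    using (∙-cancelˡ; ∙-cancelʳ; x≈z//y; //-rightDividesˡ; x∙y⁻¹≈ε⇒x≈y)
  open import Algebra.Solver.Ring.NaturalCoefficients.Default commutativeSemiring
  open import Relation.Binary.Reasoning.Setoid setoid

  -- t is a root of T² − cT + (s − k), written without subtraction.
  IsRoot : Carrier → Carrier → Carrier → Carrier → Set ℓ
  IsRoot c s k t = t * t + s ≈ t * c + k

  other-root : ∀ {c s k u} → IsRoot c s k u → IsRoot c s k (c - u)
  other-root {c} {s} {k} {u} u-root = begin
      u' * u' + s             ≈⟨ +-congˡ s≈uu'+k ⟩
      u' * u' + (u * u' + k)
        ≈⟨ solve 3 (λ u u' k → u' :* u' :+ (u :* u' :+ k) := u' :* (u' :+ u) :+ k) refl u u' k ⟩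
      u' * (u' + u) + k       ≈⟨ +-congʳ (*-congˡ u'+u≈c) ⟩
      u' * c + k              ∎
    where
    u' = c - u
    u'+u≈c : u' + u ≈ c
    u'+u≈c = //-rightDividesˡ u c
    s≈uu'+k : s ≈ u * u' + k
    s≈uu'+k = ∙-cancelˡ (u * u) _ _ (begin
      u * u + s             ≈⟨ u-root ⟩
      u * c + k             ≈⟨ +-congʳ (*-congˡ u'+u≈c) ⟨
      u * (u' + u) + k
        ≈⟨ solve 3 (λ u u' k → u :* (u' :+ u) :+ k := u :* u :+ (u :* u' :+ k)) refl u u' k ⟩
      u * u + (u * u' + k)  ∎)

  module _ (noZeroDivisors : ∀ x y → x * y ≈ 0# → x ≈ 0# ⊎ y ≈ 0#) where

    *-cancelˡ-⊎ : ∀ x y z → x * y ≈ x * z → x ≈ 0# ⊎ y ≈ z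
    *-cancelˡ-⊎ x y z xy≈xz = Sum.map₂ (x∙y⁻¹≈ε⇒x≈y y z) (noZeroDivisors x (y - z) x[y-z]≈0)
      where
      x[y-z]≈0 : x * (y - z) ≈ 0#
      x[y-z]≈0 = ∙-cancelʳ (x * z) _ _ (begin
        x * (y - z) + x * z  ≈⟨ distribˡ x (y - z) z ⟨
        x * ((y - z) + z)    ≈⟨ *-congˡ (//-rightDividesˡ z y) ⟩
        x * y                ≈⟨ xy≈xz ⟩
        x * z                ≈⟨ +-identityˡ (x * z) ⟨
        0# + x * z           ∎)

    roots : ∀ {c s k u v} → IsRoot c s k u → IsRoot c s k v → u ≈ v ⊎ u ≈ c - v
    roots {c} {s} {k} {u} {v} u-root v-root =
      Sum.map d≈0⇒u≈v d+2v≈c⇒u≈c-v (*-cancelˡ-⊎ d (d + v + v) c d[d+2v]≈dc)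
      where
      d = u - v
      d+v≈u : d + v ≈ u
      d+v≈u = //-rightDividesˡ v u
      d≈0⇒u≈v : d ≈ 0# → u ≈ v
      d≈0⇒u≈v d≈0 = begin
        u       ≈⟨ d+v≈u ⟨
        d + v   ≈⟨ +-congʳ d≈0 ⟩
        0# + v  ≈⟨ +-identityˡ v ⟩
        v       ∎
      d+2v≈c⇒u≈c-v : d + v + v ≈ c → u ≈ c - v
      d+2v≈c⇒u≈c-v eq = x≈z//y u v c (trans (+-congʳ (sym d+v≈u)) eq)
      rest = v * v + s + (v * c + k)
      d[d+2v]≈dc : d * (d + v + v) ≈ d * c
      d[d+2v]≈dc = ∙-cancelʳ rest _ _ (begin
        d * (d + v + v) + rest
          ≈⟨ solve 5 (λ d v c s k → d :* (d :+ v :+ v) :+ (v :* v :+ s :+ (v :* c :+ k))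
                                  := (d :+ v) :* (d :+ v) :+ s :+ (v :* c :+ k)) refl d v c s k ⟩
        (d + v) * (d + v) + s + (v * c + k)
          ≈⟨ +-congʳ (+-congʳ (*-cong d+v≈u d+v≈u)) ⟩
        u * u + s + (v * c + k)
          ≈⟨ +-cong u-root (sym v-root) ⟩
        u * c + k + (v * v + s)
          ≈⟨ +-congʳ (+-congʳ (*-congʳ d+v≈u)) ⟨
        (d + v) * c + k + (v * v + s)
          ≈⟨ solve 5 (λ d v c s k → (d :+ v) :* c :+ k :+ (v :* v :+ s)
                                  := d :* c :+ (v :* v :+ s :+ (v :* c :+ k))) refl d v c s k ⟩
        d * c + rest ∎)

open import Defs
open import Algebra.Structures using (IsCommutativeRing)
open import Data.Bool using (Bool; true; false; not; if_then_else_)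
open import Data.Bool.Properties using (not-involutive; not-injective; if-not)
open import Data.Empty using (⊥-elim)
open import Data.Fin using (Fin; toℕ; _≟_)
open import Data.Fin.Patterns using (0F; 1F; 2F)
open import Data.Fin.Properties using (toℕ-fromℕ<; toℕ-injective; toℕ<n; all?; any?)
open import Data.Integer using (ℤ)
open import Data.Nat using (ℕ; zero; suc; NonZero)
open import Data.Nat.Primality using (Prime; euclidsLemma)
open import Data.Product using (_×_; _,_; ∃; ∃-syntax; proj₁; proj₂)
open import Data.Product.Properties using (≡-dec)
open import Function using (_∘_)
open import Function.Bundles using (_⇔_; mk⇔; Equivalence)
open import Relation.Binary.PropositionalEquality
open import Relation.Nullary using (¬_; yes; no)
open import Relation.Nullary.Decidable using (Dec; ¬?; _×-dec_; _⊎-dec_; _→-dec_; toWitness; dec-true)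

-- The prime field and the surface M_κ(p)

module PrimeField (p : ℕ) .{{_ : NonZero p}} where

  open import Data.Nat using (_+_; _*_; _∸_; _%_; >-nonZero⁻¹)
  open import Data.Nat.DivMod using (%-distribˡ-+; %-distribˡ-*; n%n≡0; m<n⇒m%n≡m)
  open import Data.Nat.Divisibility using (_∣_; m%n≡0⇒n∣m; n∣m⇒m%n≡0)
  import Data.Nat.Properties as ℕ
  open import Algebra.Consequences.Propositional using (comm∧idˡ⇒id; comm∧invˡ⇒inv; comm∧distrʳ⇒distrˡ)

  private
    infixl 6 _+ₚ_
    infixl 7 _*ₚ_
    _+ₚ_ _*ₚ_ : Fp p → Fp p → Fp p
    _+ₚ_ = _⊕_ p
    _*ₚ_ = _⊗_ p

    toℕ-red : ∀ m → toℕ (red p m) ≡ m % p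
    toℕ-red m = toℕ-fromℕ< _

    red-cong : ∀ {m n} → m % p ≡ n % p → red p m ≡ red p n
    red-cong eq = toℕ-injective (trans (toℕ-red _) (trans eq (sym (toℕ-red _))))

    red-toℕ : ∀ a → red p (toℕ a) ≡ a
    red-toℕ a = toℕ-injective (trans (toℕ-red _) (m<n⇒m%n≡m (toℕ<n a)))

    red-+ : ∀ m n → red p m +ₚ red p n ≡ red p (m + n)
    red-+ m n = red-cong (trans (cong₂ (λ a b → (a + b) % p) (toℕ-red m) (toℕ-red n))
                                (sym (%-distribˡ-+ m n p)))

    red-* : ∀ m n → red p m *ₚ red p n ≡ red p (m * n)
    red-* m n = red-cong (trans (cong₂ (λ a b → (a * b) % p) (toℕ-red m) (toℕ-red n))
                                (sym (%-distribˡ-* m n p)))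

    +-assoc : ∀ a b c → (a +ₚ b) +ₚ c ≡ a +ₚ (b +ₚ c)
    +-assoc a b c = begin
      (a +ₚ b) +ₚ c                       ≡⟨ cong ((a +ₚ b) +ₚ_) (sym (red-toℕ c)) ⟩
      red p (toℕ a + toℕ b) +ₚ red p (toℕ c) ≡⟨ red-+ _ _ ⟩
      red p (toℕ a + toℕ b + toℕ c)       ≡⟨ cong (red p) (ℕ.+-assoc (toℕ a) _ _) ⟩
      red p (toℕ a + (toℕ b + toℕ c))     ≡⟨ sym (red-+ _ _) ⟩
      red p (toℕ a) +ₚ (b +ₚ c)           ≡⟨ cong (_+ₚ (b +ₚ c)) (red-toℕ a) ⟩
      a +ₚ (b +ₚ c)                       ∎
      where open ≡-Reasoning

    *-assoc : ∀ a b c → (a *ₚ b) *ₚ c ≡ a *ₚ (b *ₚ c)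
    *-assoc a b c = begin
      (a *ₚ b) *ₚ c                       ≡⟨ cong ((a *ₚ b) *ₚ_) (sym (red-toℕ c)) ⟩
      red p (toℕ a * toℕ b) *ₚ red p (toℕ c) ≡⟨ red-* _ _ ⟩
      red p (toℕ a * toℕ b * toℕ c)       ≡⟨ cong (red p) (ℕ.*-assoc (toℕ a) _ _) ⟩
      red p (toℕ a * (toℕ b * toℕ c))     ≡⟨ sym (red-* _ _) ⟩
      red p (toℕ a) *ₚ (b *ₚ c)           ≡⟨ cong (_*ₚ (b *ₚ c)) (red-toℕ a) ⟩
      a *ₚ (b *ₚ c)                       ∎
      where open ≡-Reasoning

    distribʳ : ∀ a b c → (b +ₚ c) *ₚ a ≡ (b *ₚ a) +ₚ (c *ₚ a)
    distribʳ a b c = begin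
      (b +ₚ c) *ₚ a                       ≡⟨ cong ((b +ₚ c) *ₚ_) (sym (red-toℕ a)) ⟩
      red p (toℕ b + toℕ c) *ₚ red p (toℕ a) ≡⟨ red-* _ _ ⟩
      red p ((toℕ b + toℕ c) * toℕ a)     ≡⟨ cong (red p) (ℕ.*-distribʳ-+ (toℕ a) (toℕ b) _) ⟩
      red p (toℕ b * toℕ a + toℕ c * toℕ a) ≡⟨ sym (red-+ _ _) ⟩
      (b *ₚ a) +ₚ (c *ₚ a)                ∎
      where open ≡-Reasoning

    +-comm : ∀ a b → a +ₚ b ≡ b +ₚ a
    +-comm a b = cong (red p) (ℕ.+-comm (toℕ a) (toℕ b))

    *-comm : ∀ a b → a *ₚ b ≡ b *ₚ a
    *-comm a b = cong (red p) (ℕ.*-comm (toℕ a) (toℕ b))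

    +-identityˡ : ∀ a → red p 0 +ₚ a ≡ a
    +-identityˡ a = trans (cong (red p 0 +ₚ_) (sym (red-toℕ a))) (trans (red-+ 0 _) (red-toℕ a))

    *-identityˡ : ∀ a → red p 1 *ₚ a ≡ a
    *-identityˡ a = trans (cong (red p 1 *ₚ_) (sym (red-toℕ a)))
                          (trans (red-* 1 _) (trans (cong (red p) (ℕ.*-identityˡ _)) (red-toℕ a)))

    -‿inverseˡ : ∀ a → (⊖_ p a) +ₚ a ≡ red p 0
    -‿inverseˡ a = begin
      red p (p ∸ toℕ a) +ₚ a              ≡⟨ cong (red p (p ∸ toℕ a) +ₚ_) (sym (red-toℕ a)) ⟩
      red p (p ∸ toℕ a) +ₚ red p (toℕ a)  ≡⟨ red-+ _ _ ⟩
      red p (p ∸ toℕ a + toℕ a)           ≡⟨ cong (red p) (ℕ.m∸n+n≡m (ℕ.<⇒≤ (toℕ<n a))) ⟩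
      red p p
        ≡⟨ red-cong (trans (n%n≡0 p) (sym (m<n⇒m%n≡m (>-nonZero⁻¹ p)))) ⟩
      red p 0                             ∎
      where open ≡-Reasoning

  Fp-isCommutativeRing : IsCommutativeRing _≡_ (_⊕_ p) (_⊗_ p) (⊖_ p) (red p 0) (red p 1)
  Fp-isCommutativeRing = record
    { isRing = record
      { +-isAbelianGroup = record
        { isGroup = record
          { isMonoid = record
            { isSemigroup = record
              { isMagma = record { isEquivalence = isEquivalence ; ∙-cong = cong₂ _ }
              ; assoc = +-assoc }
            ; identity = comm∧idˡ⇒id +-comm +-identityˡ }
          ; inverse = comm∧invˡ⇒inv +-comm -‿inverseˡ
          ; ⁻¹-cong = cong (⊖_ p) }
        ; comm = +-comm }
      ; *-cong = cong₂ _
      ; *-assoc = *-assoc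
      ; *-identity = comm∧idˡ⇒id *-comm *-identityˡ
      ; distrib = comm∧distrʳ⇒distrˡ *-comm distribʳ , distribʳ }
    ; *-comm = *-comm }

  Fp-commutativeRing : CommutativeRing _ _
  Fp-commutativeRing = record { isCommutativeRing = Fp-isCommutativeRing }

  private
    toℕ-red0 : toℕ (red p 0) ≡ 0
    toℕ-red0 = trans (toℕ-red 0) (m<n⇒m%n≡m (>-nonZero⁻¹ p))

    divisible⇒zero : ∀ a → p ∣ toℕ a → a ≡ red p 0
    divisible⇒zero a p∣a = toℕ-injective (trans (sym (m<n⇒m%n≡m (toℕ<n a)))
                                                (trans (n∣m⇒m%n≡0 _ p p∣a) (sym toℕ-red0)))

  Fp-noZeroDivisors : Prime p → ∀ a b → _⊗_ p a b ≡ red p 0 → a ≡ red p 0 ⊎ b ≡ red p 0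
  Fp-noZeroDivisors p-prime a b ab≡0 =
    Sum.map (divisible⇒zero a) (divisible⇒zero b)
      (euclidsLemma (toℕ a) (toℕ b) p-prime
        (m%n≡0⇒n∣m _ p (trans (sym (toℕ-red _)) (trans (cong toℕ ab≡0) toℕ-red0))))


module MarkovSurface (p : ℕ) .{{_ : NonZero p}} where

  open PrimeField p
  open CommutativeRing Fp-commutativeRing using (_+_; _*_; _-_; +-comm; +-group; commutativeSemiring)
  open import Algebra.Properties.Group +-group using (x≈z//y; //-rightDividesˡ)
  open import Algebra.Solver.Ring.NaturalCoefficients.Default commutativeSemiring
  open QuadraticRoots Fp-commutativeRing

  coord : Fin 3 → Tri p → Fp p
  coord 0F (x , _ , _) = x
  coord 1F (_ , y , _) = y
  coord 2F (_ , _ , z) = z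

  coord-R : ∀ {l m} → l ≢ m → ∀ W → coord l (R p m W) ≡ coord l W
  coord-R {0F} {0F} l≢m _ = ⊥-elim (l≢m refl)
  coord-R {0F} {1F} _ _ = refl
  coord-R {0F} {2F} _ _ = refl
  coord-R {1F} {0F} _ _ = refl
  coord-R {1F} {1F} l≢m _ = ⊥-elim (l≢m refl)
  coord-R {1F} {2F} _ _ = refl
  coord-R {2F} {0F} _ _ = refl
  coord-R {2F} {1F} _ _ = refl
  coord-R {2F} {2F} l≢m _ = ⊥-elim (l≢m refl)

  private
    cofactor sum-of-other-squares : Fin 3 → Tri p → Fp p
    cofactor 0F (x , y , z) = y * z
    cofactor 1F (x , y , z) = z * x
    cofactor 2F (x , y , z) = x * y
    sum-of-other-squares 0F (x , y , z) = y * y + z * z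
    sum-of-other-squares 1F (x , y , z) = x * x + z * z
    sum-of-other-squares 2F (x , y , z) = x * x + y * y

    rearrange : ∀ {a a' b b' : Fp p} → a ≡ a' → b ≡ b' → (a ≡ b) ⇔ (a' ≡ b')
    rearrange a≡a' b≡b' = mk⇔ (λ a≡b → trans (sym a≡a') (trans a≡b b≡b'))
                              (λ a'≡b' → trans a≡a' (trans a'≡b' (sym b≡b')))

    InM⇔IsRoot : ∀ κ m W → InM p κ W ⇔ IsRoot (cofactor m W) (sum-of-other-squares m W) (ιℤ p κ) (coord m W)
    InM⇔IsRoot κ 0F (x , y , z) = rearrange
      (solve 3 (λ x y z → x :* x :+ y :* y :+ z :* z := x :* x :+ (y :* y :+ z :* z)) refl x y z)
      (solve 4 (λ x y z k → x :* y :* z :+ k := x :* (y :* z) :+ k) refl x y z (ιℤ p κ))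
    InM⇔IsRoot κ 1F (x , y , z) = rearrange
      (solve 3 (λ x y z → x :* x :+ y :* y :+ z :* z := y :* y :+ (x :* x :+ z :* z)) refl x y z)
      (solve 4 (λ x y z k → x :* y :* z :+ k := y :* (z :* x) :+ k) refl x y z (ιℤ p κ))
    InM⇔IsRoot κ 2F (x , y , z) = rearrange
      (solve 3 (λ x y z → x :* x :+ y :* y :+ z :* z := z :* z :+ (x :* x :+ y :* y)) refl x y z)
      (solve 4 (λ x y z k → x :* y :* z :+ k := z :* (x :* y) :+ k) refl x y z (ιℤ p κ))

    root : ∀ κ m W → InM p κ W → IsRoot (cofactor m W) (sum-of-other-squares m W) (ιℤ p κ) (coord m W)
    root κ m W = Equivalence.to (InM⇔IsRoot κ m W)

    c-[c-u]≡u : ∀ c u → c - (c - u) ≡ u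
    c-[c-u]≡u c u = sym (x≈z//y u (c - u) c (trans (+-comm u _) (//-rightDividesˡ u c)))

  R-involutive : ∀ m W → R p m (R p m W) ≡ W
  R-involutive 0F (x , y , z) = cong (_, y , z) (c-[c-u]≡u (y * z) x)
  R-involutive 1F (x , y , z) = cong (λ t → x , t , z) (c-[c-u]≡u (z * x) y)
  R-involutive 2F (x , y , z) = cong (λ t → x , y , t) (c-[c-u]≡u (x * y) z)

  InM-R : ∀ κ m W → InM p κ W → InM p κ (R p m W)
  InM-R κ 0F W@(x , y , z) W∈M = Equivalence.from (InM⇔IsRoot κ 0F (R p 0F W))
    (other-root {y * z} {y * y + z * z} {ιℤ p κ} {x} (root κ 0F W W∈M))
  InM-R κ 1F W@(x , y , z) W∈M = Equivalence.from (InM⇔IsRoot κ 1F (R p 1F W))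
    (other-root {z * x} {x * x + z * z} {ιℤ p κ} {y} (root κ 1F W W∈M))
  InM-R κ 2F W@(x , y , z) W∈M = Equivalence.from (InM⇔IsRoot κ 2F (R p 2F W))
    (other-root {x * y} {x * x + y * y} {ιℤ p κ} {z} (root κ 2F W W∈M))

  vieta : Prime p → ∀ κ m W Z → InM p κ W → InM p κ Z → (∀ l → l ≢ m → coord l W ≡ coord l Z) →
          W ≡ Z ⊎ W ≡ R p m Z
  vieta p-prime κ 0F W@(_ , y' , z') Z@(x , y , z) W∈M Z∈M agree with agree 1F (λ ()) | agree 2F (λ ())
  ... | refl | refl = Sum.map (cong (_, y , z)) (cong (_, y , z))
    (roots (Fp-noZeroDivisors p-prime) (root κ 0F W W∈M) (root κ 0F Z Z∈M))
  vieta p-prime κ 1F W@(x' , _ , z') Z@(x , y , z) W∈M Z∈M agree with agree 0F (λ ()) | agree 2F (λ ())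
  ... | refl | refl = Sum.map (cong (λ t → x , t , z)) (cong (λ t → x , t , z))
    (roots (Fp-noZeroDivisors p-prime) (root κ 1F W W∈M) (root κ 1F Z Z∈M))
  vieta p-prime κ 2F W@(x' , y' , _) Z@(x , y , z) W∈M Z∈M agree with agree 0F (λ ()) | agree 1F (λ ())
  ... | refl | refl = Sum.map (cong (λ t → x , y , t)) (cong (λ t → x , y , t))
    (roots (Fp-noZeroDivisors p-prime) (root κ 2F W W∈M) (root κ 2F Z Z∈M))

open import Data.Nat using (_+_; _*_; _≤_; _<_; z≤n; s≤s; z<s; _≤?_)
open import Data.Nat.Properties
  using (+-comm; +-suc; +-identityʳ; *-suc; ≤-refl; ≤-reflexive; ≤-trans; ≤-pred; <⇒≤; <⇒≱;
         n<1+n; n≤1+n; m≤n⇒m≤1+n; m≤m+n; m≤n+m; <-≤-trans; <-cmp; ≰⇒>; m≤n⇒∃[o]m+o≡n;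
         m≤n⇒m<n∨m≡n; +-cancelˡ-≤; +-mono-≤; +-monoʳ-≤; *-monoʳ-≤)
open import Relation.Binary.Definitions using (tri<; tri≈; tri>)

-- Walks alternating two involutions

isEven-even+ : ∀ d a → isEven d ≡ true → isEven (d + a) ≡ isEven a
isEven-even+ zero          a _      = refl
isEven-even+ (suc (suc d)) a d-even =
  trans (not-involutive _) (isEven-even+ d a (trans (sym (not-involutive _)) d-even))

isEven-2* : ∀ m → isEven (2 * m) ≡ true
isEven-2* zero    = refl
isEven-2* (suc m) = trans (cong isEven (*-suc 2 m)) (trans (not-involutive _) (isEven-2* m))

m≤n⊎m≡1+n+k : ∀ n m → m ≤ n ⊎ ∃[ k ] m ≡ suc n + k
m≤n⊎m≡1+n+k n m with m ≤? n
... | yes m≤n = inj₁ m≤n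
... | no  m≰n with m≤n⇒∃[o]m+o≡n (≰⇒> m≰n)
...   | k , eq = inj₂ (k , sym eq)

module AlternatingWalk {A : Set} (step : Bool → A → A)
  (step-involutive : ∀ b x → step b (step b x) ≡ x)
  (V : ℕ → A) (V-suc : ∀ t → V (suc t) ≡ step (isEven t) (V t))
  where

  V-pred : ∀ t → V t ≡ step (isEven t) (V (suc t))
  V-pred t = trans (sym (step-involutive _ (V t))) (cong (step (isEven t)) (sym (V-suc t)))

  step-back : ∀ {a b} → isEven a ≡ isEven b → V (suc a) ≡ V (suc b) → V a ≡ V b
  step-back {a} {b} a~b h = trans (V-pred a) (trans (cong₂ step a~b h) (sym (V-pred b)))

  step-across : ∀ {a b} → isEven a ≡ isEven b → V (suc a) ≡ V b → V a ≡ V (suc b)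
  step-across {a} {b} a~b h = trans (V-pred a) (trans (cong₂ step a~b h) (sym (V-suc b)))

  translate-to-origin : ∀ a d → isEven d ≡ true → V a ≡ V (d + a) → V 0 ≡ V d
  translate-to-origin zero    d _      h = trans h (cong V (+-identityʳ d))
  translate-to-origin (suc a) d d-even h = translate-to-origin a d d-even
    (step-back (sym (isEven-even+ d a d-even)) (trans h (cong V (+-suc d a))))

  fold-to-fixed-step : ∀ a d → isEven d ≡ false → V a ≡ V (d + a) →
                       ∃[ c ] a ≤ c × c < d + a × V c ≡ V (suc c)
  fold-to-fixed-step a 1 _ h = a , ≤-refl , n<1+n a , h
  fold-to-fixed-step a (suc (suc d)) d-odd h
    with fold-to-fixed-step (suc a) d (trans (sym (not-involutive _)) d-odd) folded
    where
    folded : V (suc a) ≡ V (d + suc a)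
    folded = sym (trans (cong V (+-suc d a))
      (step-across (isEven-even+ (suc d) a (cong not (trans (sym (not-involutive _)) d-odd))) (sym h)))
  ... | c , a<c , c<d+1+a , fixed =
    c , <⇒≤ a<c , ≤-trans c<d+1+a (≤-trans (≤-reflexive (+-suc d a)) (n≤1+n _)) , fixed

  mirror : ∀ a b → isEven a ≡ not (isEven b) → V a ≡ V b → V 0 ≡ V (a + b)
  mirror zero    b _      h = h
  mirror (suc a) b parity h = trans
    (mirror a (suc b) (trans (not-injective parity) (sym (not-involutive _)))
      (step-across (not-injective parity) h))
    (cong V (+-suc a b))

  reflect-fixed-step : ∀ c → V c ≡ V (suc c) → V 0 ≡ V (c + suc c)
  reflect-fixed-step c = mirror c (suc c) (sym (not-involutive _))

  coincidence : ∀ a d → V a ≡ V (d + a) →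
                V 0 ≡ V d ⊎ ∃[ c ] a ≤ c × c < d + a × V c ≡ V (suc c)
  coincidence a d h with isEven d in parity
  ... | true  = inj₁ (translate-to-origin a d parity h)
  ... | false = inj₂ (fold-to-fixed-step a d parity h)

  preserved : (P : A → Set) → (∀ b x → P x → P (step b x)) → P (V 0) → ∀ t → P (V t)
  preserved P P-step P-start zero    = P-start
  preserved P P-step P-start (suc t) = subst P (sym (V-suc t)) (P-step _ _ (preserved P P-step P-start t))

-- Proper sextuples

SharedIndex : (i j i' j' : Fin 3) → Set
SharedIndex i j i' j' =
  ∃ λ m → (m ≡ i ⊎ m ≡ j) × (m ≡ i' ⊎ m ≡ j') ×
          (∀ l → l ≢ m → (l ≢ i × l ≢ j) ⊎ (l ≢ i' × l ≢ j'))

shared-index : ∀ i j i' j' → i ≢ j → i' ≢ j' → (i , j) ≢ (i' , j') → (j , i) ≢ (i' , j') →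
               SharedIndex i j i' j'
shared-index = toWitness {a? = all? λ i → all? λ j → all? λ i' → all? λ j' →
                                 ¬? (i ≟ j) →-dec ¬? (i' ≟ j') →-dec
                                 ¬? (pair? (i , j) (i' , j')) →-dec ¬? (pair? (j , i) (i' , j')) →-dec
                                 shared? i j i' j'} _
  where
  pair? = ≡-dec _≟_ _≟_
  avoids? : ∀ l i j → Dec (l ≢ i × l ≢ j)
  avoids? l i j = ¬? (l ≟ i) ×-dec ¬? (l ≟ j)
  shared? : ∀ i j i' j' → Dec (SharedIndex i j i' j')
  shared? i j i' j' = any? λ m → ((m ≟ i) ⊎-dec (m ≟ j)) ×-dec ((m ≟ i') ⊎-dec (m ≟ j')) ×-dec
                                  all? λ l → ¬? (l ≟ m) →-dec (avoids? l i j ⊎-dec avoids? l i' j')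

len-refl : ∀ n i → len n i i ≡ 1
len-refl n i = cong (if_then 1 else 2 * n) (dec-true (i ≟ i) refl)

module ProperSextuple {p : ℕ} .{{_ : NonZero p}} (κ : ℤ) (n : ℕ) (X Y : Fin 3 → Tri p)
  (X∈M : ∀ i → InM p κ (X i))
  (Y≡RX : ∀ i → Y i ≡ R p i (X i))
  (iterate≡Y : ∀ i j → i ≢ j → iter n (λ W → R p i (R p j W)) (X i) ≡ Y j)
  (X-injective : ∀ i j → i ≢ j → X i ≢ X j)
  (X≢Y : ∀ i j → X i ≢ Y j)
  (internal≢X,Y : ∀ i j → i ≢ j → ∀ k → 0 < k → k < 2 * n → ∀ l →
                    pv p X i j k ≢ X l × pv p X i j k ≢ Y l)
  where

  open MarkovSurface p

  N : ℕ
  N = 2 * n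

  P : Fin 3 → Fin 3 → ℕ → Tri p
  P = pv p X

  module PathWalk (i j : Fin 3) = AlternatingWalk (λ b → R p (if b then j else i))
    (λ b → R-involutive (if b then j else i)) (P i j) (λ _ → refl)

  X≡RY : ∀ i → X i ≡ R p i (Y i)
  X≡RY i = trans (sym (R-involutive i (X i))) (cong (R p i) (sym (Y≡RX i)))

  P-at-even : ∀ i j m → P i j (2 * m) ≡ iter m (λ W → R p i (R p j W)) (X i)
  P-at-even i j zero    = refl
  P-at-even i j (suc m) = begin
    P i j (2 * suc m)               ≡⟨ cong (P i j) (*-suc 2 m) ⟩
    P i j (suc (suc (2 * m)))
      ≡⟨ cong (λ b → R p (if not b then j else i) (R p (if b then j else i) (P i j (2 * m))))
              (isEven-2* m) ⟩
    R p i (R p j (P i j (2 * m)))   ≡⟨ cong (λ W → R p i (R p j W)) (P-at-even i j m) ⟩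
    iter (suc m) (λ W → R p i (R p j W)) (X i) ∎
    where open ≡-Reasoning

  P-end : ∀ {i j} → i ≢ j → P i j N ≡ Y j
  P-end {i} {j} i≢j = trans (P-at-even i j n) (iterate≡Y i j i≢j)

  P-after-end : ∀ {i j} → i ≢ j → P i j (suc N) ≡ X j
  P-after-end {i} {j} i≢j = begin
    R p (if isEven N then j else i) (P i j N)
      ≡⟨ cong₂ (λ b → R p (if b then j else i)) (isEven-2* n) (P-end i≢j) ⟩
    R p j (Y j)
      ≡⟨ sym (X≡RY j) ⟩
    X j ∎
    where open ≡-Reasoning

  P-continues : ∀ {i j} → i ≢ j → ∀ k → P i j (suc N + k) ≡ P j i k
  P-continues i≢j zero    = trans (cong (P _ _) (+-identityʳ (suc N))) (P-after-end i≢j)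
  P-continues {i} {j} i≢j (suc k) = begin
    P i j (suc N + suc k)                                    ≡⟨ cong (P i j) (+-suc (suc N) k) ⟩
    R p (if not (isEven (N + k)) then j else i) (P i j (suc N + k))
      ≡⟨ cong₂ (λ b → R p (if not b then j else i)) (isEven-even+ N k (isEven-2* n)) (P-continues i≢j k) ⟩
    R p (if not (isEven k) then j else i) (P j i k)
      ≡⟨ cong (λ l → R p l (P j i k)) (if-not (isEven k)) ⟩
    P j i (suc k) ∎
    where open ≡-Reasoning

  internal≢X : ∀ {i j} → i ≢ j → ∀ {k} → 0 < k → k < N → ∀ l → P i j k ≢ X l
  internal≢X i≢j 0<k k<N l = proj₁ (internal≢X,Y _ _ i≢j _ 0<k k<N l)

  internal≢Y : ∀ {i j} → i ≢ j → ∀ {k} → 0 < k → k < N → ∀ l → P i j k ≢ Y l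
  internal≢Y i≢j 0<k k<N l = proj₂ (internal≢X,Y _ _ i≢j _ 0<k k<N l)

  P≢X : ∀ {i j} → i ≢ j → ∀ {k} → 0 < k → k ≤ N → ∀ l → P i j k ≢ X l
  P≢X i≢j 0<k k≤N l with m≤n⇒m<n∨m≡n k≤N
  ... | inj₁ k<N  = internal≢X i≢j 0<k k<N l
  ... | inj₂ refl = λ Y≡X → X≢Y l _ (sym (trans (sym (P-end i≢j)) Y≡X))

  X-once-on-cycle : ∀ {i j} → i ≢ j → ∀ {m} → 0 < m → m ≤ suc N + N → P i j m ≢ X i
  X-once-on-cycle {i} {j} i≢j {m} 0<m m≤2N+1 with m≤n⊎m≡1+n+k N m
  ... | inj₁ m≤N            = P≢X i≢j 0<m m≤N i
  ... | inj₂ (zero  , refl) = λ h → X-injective j i (i≢j ∘ sym) (trans (sym (P-continues i≢j 0)) h)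
  ... | inj₂ (suc k , refl) = λ h → P≢X (i≢j ∘ sym) (s≤s z≤n) (+-cancelˡ-≤ (suc N) _ _ m≤2N+1) i
                                      (trans (sym (P-continues i≢j (suc k))) h)

  no-fixed-step : ∀ {i j} → i ≢ j → ∀ {c} → c < N → P i j c ≢ P i j (suc c)
  no-fixed-step i≢j {c} c<N fixed = X-once-on-cycle i≢j
    (<-≤-trans z<s (m≤n+m (suc c) c))
    (m≤n⇒m≤1+n (+-mono-≤ (<⇒≤ c<N) c<N))
    (sym (PathWalk.reflect-fixed-step _ _ c fixed))

  cycle-no-fixed-step : ∀ {i j} → i ≢ j → ∀ {c} → c ≤ N + N → P i j c ≢ P i j (suc c)
  cycle-no-fixed-step {i} {j} i≢j {c} c≤2N with m≤n⊎m≡1+n+k N c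
  ... | inj₁ c≤N with m≤n⇒m<n∨m≡n c≤N
  ...   | inj₁ c<N  = no-fixed-step i≢j c<N
  ...   | inj₂ refl = λ h → X≢Y j j (trans (sym (P-after-end i≢j)) (trans (sym h) (P-end i≢j)))
  cycle-no-fixed-step {i} {j} i≢j c≤2N | inj₂ (k , refl) = λ h →
    no-fixed-step (i≢j ∘ sym) (+-cancelˡ-≤ N (suc k) N (subst (_≤ N + N) (sym (+-suc N k)) c≤2N))
      (trans (sym (P-continues i≢j k))
        (trans h (trans (cong (P i j) (sym (+-suc (suc N) k))) (P-continues i≢j (suc k)))))

  cycle-injective : ∀ {i j} → i ≢ j → ∀ {a b} → a < b → b ≤ suc N + N → P i j a ≢ P i j b
  cycle-injective {i} {j} i≢j {a} a<b b≤2N+1 Pa≡Pb with m≤n⇒∃[o]m+o≡n a<b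
  ... | o , refl with PathWalk.coincidence i j a (suc o) (trans Pa≡Pb (cong (P i j) (cong suc (+-comm a o))))
  ...   | inj₁ P0≡Pd = X-once-on-cycle i≢j z<s (≤-trans (s≤s (m≤n+m o a)) b≤2N+1) (sym P0≡Pd)
  ...   | inj₂ (c , _ , c<b , fixed) =
    cycle-no-fixed-step i≢j (≤-pred (≤-trans (subst (c <_) (cong suc (+-comm o a)) c<b) b≤2N+1)) fixed

  lab-pair : ∀ i j k → (lab i j k ≡ j × lab i j (suc k) ≡ i) ⊎ (lab i j k ≡ i × lab i j (suc k) ≡ j)
  lab-pair i j k with isEven k
  ... | true  = inj₁ (refl , refl)
  ... | false = inj₂ (refl , refl)

  leaving-step : ∀ {i j} → i ≢ j → ∀ {c} → c < N → R p (lab i j c) (P i j c) ≢ P i j c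
  leaving-step i≢j c<N h = no-fixed-step i≢j c<N (sym h)

  arriving-step : ∀ {i j} → i ≢ j → ∀ {c} → c < N → R p (lab i j c) (P i j (suc c)) ≢ P i j (suc c)
  arriving-step {i} {j} i≢j {c} c<N h =
    no-fixed-step i≢j c<N (trans (sym (R-involutive (lab i j c) (P i j c))) h)

  internal-not-fixed : ∀ i j → i ≢ j → ∀ k → 0 < k → k < N →
                       R p i (P i j k) ≢ P i j k × R p j (P i j k) ≢ P i j k
  internal-not-fixed i j i≢j (suc k) _ k+1<N with lab-pair i j k
  ... | inj₁ (lab≡j , lab'≡i) =
    fixed-by lab'≡i (leaving-step i≢j k+1<N) , fixed-by lab≡j (arriving-step i≢j (<⇒≤ k+1<N))
    where fixed-by = subst (λ l → R p l (P i j (suc k)) ≢ P i j (suc k))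
  ... | inj₂ (lab≡i , lab'≡j) =
    fixed-by lab≡i (arriving-step i≢j (<⇒≤ k+1<N)) , fixed-by lab'≡j (leaving-step i≢j k+1<N)
    where fixed-by = subst (λ l → R p l (P i j (suc k)) ≢ P i j (suc k))

  P∈M : ∀ i j k → InM p κ (P i j k)
  P∈M i j = PathWalk.preserved i j (InM p κ) (λ b → InM-R κ (if b then j else i)) (X∈M i)

  coord-along : ∀ {i j l} → l ≢ i → l ≢ j → ∀ k → coord l (P i j k) ≡ coord l (X i)
  coord-along {i} {j} {l} l≢i l≢j =
    PathWalk.preserved i j (λ W → coord l W ≡ coord l (X i)) (λ b W → trans (coord-R (l≢label b) W)) refl
    where
    l≢label : ∀ b → l ≢ (if b then j else i)
    l≢label true  = l≢j
    l≢label false = l≢i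

  coord-vs-X : ∀ {i j l m} → i ≢ j → l ≢ i → l ≢ j → m ≡ i ⊎ m ≡ j →
               ∀ k → coord l (P i j k) ≡ coord l (X m)
  coord-vs-X i≢j l≢i l≢j (inj₁ refl) k = coord-along l≢i l≢j k
  coord-vs-X {i} {j} {l} i≢j l≢i l≢j (inj₂ refl) k = trans (coord-along l≢i l≢j k)
    (sym (trans (cong (coord l) (sym (P-after-end i≢j))) (coord-along {i} {j} l≢i l≢j (suc N))))

  no-shared-internal-vertex : Prime p → ∀ {i j i' j'} → i ≢ j → i' ≢ j' → SharedIndex i j i' j' →
                              ∀ {k} k' → 0 < k → k < N → P i j k ≢ P i' j' k'
  no-shared-internal-vertex p-prime {i} {j} {i'} {j'} i≢j i'≢j' (m , m∈ij , m∈i'j' , off-m)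
                            {k} k' 0<k k<N W≡W'
    with vieta p-prime κ m (P i j k) (X m) (P∈M i j k) (X∈M m) agree
    where
    agree : ∀ l → l ≢ m → coord l (P i j k) ≡ coord l (X m)
    agree l l≢m with off-m l l≢m
    ... | inj₁ (l≢i , l≢j)   = coord-vs-X i≢j l≢i l≢j m∈ij k
    ... | inj₂ (l≢i' , l≢j') = trans (cong (coord l) W≡W') (coord-vs-X i'≢j' l≢i' l≢j' m∈i'j' k')
  ... | inj₁ W≡X = internal≢X i≢j 0<k k<N m W≡X
  ... | inj₂ W≡RX = internal≢Y i≢j 0<k k<N m (trans W≡RX (sym (Y≡RX m)))

  long-internal-vertex-unique : Prime p → ∀ {i j i' j'} → i ≢ j → (i , j) ≢ (i' , j') → ∀ {k k'} →
                                0 < k → k < N → k' ≤ len n i' j' → P i j k ≢ P i' j' k'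
  long-internal-vertex-unique p-prime {i} {j} {i'} {j'} i≢j ij≢i'j' {k} {k'} 0<k k<N k'≤len
    with i' ≟ j'
  ... | yes refl with k'≤len
  ...   | z≤n     = internal≢X i≢j 0<k k<N i'
  ...   | s≤s z≤n = λ h → internal≢Y i≢j 0<k k<N i' (trans h (sym (Y≡RX i')))
  long-internal-vertex-unique p-prime {i} {j} {i'} {j'} i≢j ij≢i'j' {k} {k'} 0<k k<N k'≤N | no i'≢j'
    with ≡-dec _≟_ _≟_ (j , i) (i' , j')
  ... | yes refl = λ h → cycle-injective i≢j (≤-trans k<N (≤-trans (n≤1+n N) (m≤m+n (suc N) k')))
                           (+-monoʳ-≤ (suc N) k'≤N) (trans h (sym (P-continues i≢j k')))
  ... | no ji≢i'j' = no-shared-internal-vertex p-prime i≢j i'≢j'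
                       (shared-index i j i' j' i≢j i'≢j' ij≢i'j' ji≢i'j') k' 0<k k<N

  internal-vertex-unique : Prime p → ∀ i j i' j' → (i , j) ≢ (i' , j') → ∀ k k' →
                           0 < k → k < len n i j → k' ≤ len n i' j' → P i j k ≢ P i' j' k'
  internal-vertex-unique p-prime i j i' j' ij≢i'j' k k' 0<k k<len with i ≟ j
  ... | yes refl = ⊥-elim (<⇒≱ k<len 0<k)
  ... | no i≢j   = long-internal-vertex-unique p-prime i≢j ij≢i'j' 0<k k<len

  path-vertices-distinct : ∀ i j k k' → k ≤ len n i j → k' ≤ len n i j → k ≢ k' → P i j k ≢ P i j k'
  path-vertices-distinct i j k k' k≤len k'≤len k≢k' with i ≟ j
  path-vertices-distinct i j _ _ z≤n       z≤n       k≢k' | yes refl = ⊥-elim (k≢k' refl)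
  path-vertices-distinct i j _ _ z≤n       (s≤s z≤n) _    | yes refl =
    λ h → X≢Y i i (trans h (sym (Y≡RX i)))
  path-vertices-distinct i j _ _ (s≤s z≤n) z≤n       _    | yes refl =
    λ h → X≢Y i i (trans (sym h) (sym (Y≡RX i)))
  path-vertices-distinct i j _ _ (s≤s z≤n) (s≤s z≤n) k≢k' | yes refl = ⊥-elim (k≢k' refl)
  path-vertices-distinct i j k k' k≤N k'≤N k≢k' | no i≢j with <-cmp k k'
  ... | tri< k<k' _ _ = cycle-injective i≢j k<k' (≤-trans k'≤N N≤2N+1)
    where N≤2N+1 = m≤n⇒m≤1+n (m≤m+n N N)
  ... | tri≈ _ k≡k' _ = ⊥-elim (k≢k' k≡k')
  ... | tri> _ _ k'<k = cycle-injective i≢j k'<k (≤-trans k≤N N≤2N+1) ∘ sym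
    where N≤2N+1 = m≤n⇒m≤1+n (m≤m+n N N)

  path-ends : ∀ i j → P i j (len n i j) ≡ Y j
  path-ends i j with i ≟ j
  ... | yes refl = sym (Y≡RX i)
  ... | no i≢j   = P-end i≢j

  SameEdge-sym : ∀ {e e'} → SameEdge p e e' → SameEdge p e' e
  SameEdge-sym (l≡l' , inj₁ (a≡a' , b≡b')) = sym l≡l' , inj₁ (sym a≡a' , sym b≡b')
  SameEdge-sym (l≡l' , inj₂ (a≡b' , b≡a')) = sym l≡l' , inj₂ (sym b≡a' , sym a≡b')

  1<N : 0 < n → 1 < N
  1<N = *-monoʳ-≤ 2

  long-edge-unshared : Prime p → 0 < n → ∀ {i j i' j'} → i ≢ j → (i , j) ≢ (i' , j') → ∀ {k k'} →
                       k < N → k' < len n i' j' → ¬ SameEdge p (pe p X i j k) (pe p X i' j' k')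
  long-edge-unshared p-prime 0<n {i} {j} {i'} {j'} i≢j ij≢i'j' {k} {k'} k<N k'<len (_ , endpoints)
    with k | endpoints
  ... | zero  | inj₁ (_ , to≡to)     =
    long-internal-vertex-unique p-prime i≢j ij≢i'j' z<s (1<N 0<n) k'<len to≡to
  ... | zero  | inj₂ (_ , to≡from)   =
    long-internal-vertex-unique p-prime i≢j ij≢i'j' z<s (1<N 0<n) (<⇒≤ k'<len) to≡from
  ... | suc _ | inj₁ (from≡from , _) =
    long-internal-vertex-unique p-prime i≢j ij≢i'j' z<s k<N (<⇒≤ k'<len) from≡from
  ... | suc _ | inj₂ (from≡to , _)   =
    long-internal-vertex-unique p-prime i≢j ij≢i'j' z<s k<N k'<len from≡to

  edges-unshared : Prime p → 0 < n → ∀ i j i' j' → (i , j) ≢ (i' , j') → ∀ k k' →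
                   k < len n i j → k' < len n i' j' → ¬ SameEdge p (pe p X i j k) (pe p X i' j' k')
  edges-unshared p-prime 0<n i j i' j' ij≢i'j' k k' k<len k'<len with i ≟ j
  ... | no i≢j = long-edge-unshared p-prime 0<n i≢j ij≢i'j' k<len k'<len
  ... | yes refl with i' ≟ j'
  ...   | no i'≢j' = long-edge-unshared p-prime 0<n i'≢j' (ij≢i'j' ∘ sym) k'<len
                       (subst (k <_) (sym (len-refl n i)) k<len) ∘ SameEdge-sym
  ...   | yes refl with k<len | k'<len
  ...     | s≤s z≤n | s≤s z≤n = λ (i≡i' , _) → ij≢i'j' (cong₂ _,_ i≡i' i≡i')

lemma3p2 : (p : ℕ) .{{_ : NonZero p}} → Prime p → 3 < p →
           (κ : ℤ) (n : ℕ) → 0 < n →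
           (X Y : Fin 3 → Tri p) → IsProper p κ n X Y →
           ((i j : Fin 3) → i ≢ j → (k : ℕ) → 0 < k → k < 2 * n →
              R p i (pv p X i j k) ≢ pv p X i j k ×
              R p j (pv p X i j k) ≢ pv p X i j k) ×
           ((i j i' j' : Fin 3) → (i , j) ≢ (i' , j') → (k k' : ℕ) →
              k < len n i j → k' < len n i' j' →
              ¬ SameEdge p (pe p X i j k) (pe p X i' j' k')) ×
           IsK33Subdivision p n X Y
lemma3p2 p p-prime _ κ n 0<n X Y
  (((X∈M , _ , Y≡RX , iterate≡Y) , X-injective , Y-injective , X≢Y) , internal≢X,Y) =
  internal-not-fixed ,
  edges-unshared p-prime 0<n ,
  X-injective , Y-injective , X≢Y ,
  path-ends , path-vertices-distinct , internal-vertex-unique p-prime , edges-unshared p-prime 0<n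
  where open ProperSextuple κ n X Y X∈M Y≡RX iterate≡Y X-injective X≢Y internal≢X,Y
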